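{- Let $\pi\in S_n$ and let $w_0=n(n-1)\cdots 21$. Then the noncrossing arc diagrams $\delta(\pi)$ and $\delta(w_0\pi w_0)$ are related by the half turn that sends the point labeled $i$ to the point labeled $n+1-i$ for each $i$.
   Context: Permutations $\pi\in S_n$ are written in one-line notation $\pi_1\cdots\pi_n$; $w_0\pi w_0$ has one-line notation $(n+1-\pi_n)(n+1-\pi_{n-1})\cdots(n+1-\pi_1)$. Place points labeled $1,\ldots,n$ from bottom to top on a vertical line, positioned so that a half turn (rotation by $180^\circ$) sends point $i$ to point $n+1-i$. An arc is a curve from a point $q$ to a strictly lower point $p$, monotone downward, touching no other labeled point, passing left or right of each point strictly between; arcs and diagrams are considered up to combinatorial equivalence (same endpoints and same sets of points on each side). A noncrossing arc diagram is a set of arcs pairwise not intersecting except possibly at a common endpoint and with no two sharing an upper endpoint or sharing a lower endpoint. The map $\delta$: for each $i$ with $\pi_i>\pi_{i+1}$, $\delta(\pi)$ contains an arc from $\pi_i$ down to $\pi_{i+1}$ passing to the right of every $\pi_j$ with $\pi_{i+1}<\pi_j<\pi_i$ and $j<i$, and to the left of every such $\pi_j$ with $j>i+1$; these are all its arcs. -}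

module Defs where

open import Data.Nat using (ℕ; suc)
open import Data.Fin using (Fin; toℕ; opposite; _<_)
open import Data.Fin.Permutation using (Permutation′; reverse; _∘ₚ_; _⟨$⟩ʳ_)
open import Data.Product using (Σ; ∃; _×_; _,_)
open import Relation.Binary.PropositionalEquality using (_≡_)

-- Points are labelled by Fin n (label i+1 in the paper ↔ i : Fin n),
-- ordered bottom (0) to top (n-1).

data Side : Set where
  left right : Side

flipSide : Side → Side
flipSide left  = right
flipSide right = left

-- An arc, combinatorially: upper endpoint, lower endpoint, and the side
-- on which each point is passed.  Only the values of `side` at points
-- strictly between `bottom` and `top` are meaningful (see _≈ᵃ_).
record Arc (n : ℕ) : Set where
  constructor arc
  field
    bottom : Fin n
    top    : Fin n
    side   : Fin n → Side
open Arc public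

_≈ᵃ_ : ∀ {n} → Arc n → Arc n → Set
a ≈ᵃ b = (bottom a ≡ bottom b) × (top a ≡ top b) ×
         (∀ j → bottom a < j → j < top a → side a j ≡ side b j)

conjW0 : ∀ {n} → Permutation′ n → Permutation′ n
conjW0 π = reverse ∘ₚ π ∘ₚ reverse

halfTurn : ∀ {n} → Arc n → Arc n
halfTurn a = arc (opposite (top a)) (opposite (bottom a))
                 (λ j → flipSide (side a (opposite j)))

_∈δ_ : ∀ {n} → Arc n → Permutation′ n → Set
_∈δ_ {n} a π =
  Σ (Fin n) λ i → Σ (Fin n) λ i' →
    (toℕ i' ≡ suc (toℕ i)) ×
    (π ⟨$⟩ʳ i' < π ⟨$⟩ʳ i) ×
    (top a ≡ π ⟨$⟩ʳ i) ×
    (bottom a ≡ π ⟨$⟩ʳ i') ×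
    (∀ j → π ⟨$⟩ʳ i' < π ⟨$⟩ʳ j → π ⟨$⟩ʳ j < π ⟨$⟩ʳ i →
       (j < i → side a (π ⟨$⟩ʳ j) ≡ right) ×
       (i' < j → side a (π ⟨$⟩ʳ j) ≡ left))

-- Conjugation by w₀ reads π backwards and complements its values: a descent
-- of π at positions i, i+1 becomes a descent of w₀πw₀ at the mirrored
-- positions, between the complemented values, so its arc is the half turn of
-- the original one.  Mirroring positions exchanges "before the descent" with
-- "after the descent", which is exactly the exchange of right and left
-- performed by the half turn.  As both operations are involutions (up to
-- combinatorial equivalence of arcs), transport in one direction already
-- gives both inclusions.
module Submission where

open import Defs
open import Data.Nat using (ℕ; suc; s≤s)
import Data.Nat as Nat
open import Data.Nat.Properties using (∸-monoʳ-<; +-∸-assoc)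
open import Data.Fin using (Fin; toℕ; opposite; _<_)
open import Data.Fin.Properties using (opposite-prop; opposite-involutive; toℕ<n)
open import Data.Fin.Permutation using (Permutation′; _⟨$⟩ʳ_)
open import Data.Product using (Σ; _×_; _,_; proj₁; proj₂)
open import Function using (_∘_)
open import Relation.Binary.PropositionalEquality
  using (_≡_; refl; sym; trans; cong; subst; subst₂; module ≡-Reasoning)

private
  variable
    n : ℕ

opposite-reverses-< : {i j : Fin n} → i < j → opposite j < opposite i
opposite-reverses-< {i = i} {j} i<j rewrite opposite-prop i | opposite-prop j =
  ∸-monoʳ-< (s≤s i<j) (toℕ<n j)

opposite-reflects-< : {i j : Fin n} → opposite j < opposite i → i < j
opposite-reflects-< {i = i} {j} =
  subst₂ _<_ (opposite-involutive i) (opposite-involutive j) ∘ opposite-reverses-<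

<-opposite-swap : {i j : Fin n} → i < opposite j → j < opposite i
<-opposite-swap {j = j} = subst (_< _) (opposite-involutive j) ∘ opposite-reverses-<

opposite-<-swap : {i j : Fin n} → opposite i < j → opposite j < i
opposite-<-swap {i = i} = subst (_ <_) (opposite-involutive i) ∘ opposite-reverses-<

opposite-adjacent : {i i' : Fin n} → toℕ i' ≡ suc (toℕ i) →
                    toℕ (opposite i) ≡ suc (toℕ (opposite i'))
opposite-adjacent {n} {i} {i'} i'≡1+i = begin
  toℕ (opposite i)                    ≡⟨ opposite-prop i ⟩
  n Nat.∸ suc (toℕ i)                 ≡⟨ +-∸-assoc 1 (subst (Nat._< n) i'≡1+i (toℕ<n i')) ⟩
  suc (n Nat.∸ suc (suc (toℕ i)))     ≡⟨ cong (λ m → suc (n Nat.∸ suc m)) i'≡1+i ⟨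
  suc (n Nat.∸ suc (toℕ i'))          ≡⟨ cong suc (opposite-prop i') ⟨
  suc (toℕ (opposite i'))             ∎
  where open ≡-Reasoning

record _Mirrors_ (σ π : Permutation′ n) : Set where
  constructor mirroring
  field
    mirror : ∀ j → σ ⟨$⟩ʳ opposite j ≡ opposite (π ⟨$⟩ʳ j)
open _Mirrors_

conjW0-mirrors : (π : Permutation′ n) → conjW0 π Mirrors π
conjW0-mirrors π = mirroring λ j → cong (opposite ∘ (π ⟨$⟩ʳ_)) (opposite-involutive j)

mirrors-sym : {σ π : Permutation′ n} → σ Mirrors π → π Mirrors σ
mirrors-sym {σ = σ} {π} σ∼π = mirroring λ j → begin
  π ⟨$⟩ʳ opposite j                           ≡⟨ opposite-involutive _ ⟨
  opposite (opposite (π ⟨$⟩ʳ opposite j))     ≡⟨ cong opposite (mirror σ∼π (opposite j)) ⟨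
  opposite (σ ⟨$⟩ʳ opposite (opposite j))     ≡⟨ cong (opposite ∘ (σ ⟨$⟩ʳ_)) (opposite-involutive j) ⟩
  opposite (σ ⟨$⟩ʳ j)                         ∎
  where open ≡-Reasoning

halfTurn-involutive : (a : Arc n) → halfTurn (halfTurn a) ≈ᵃ a
halfTurn-involutive a =
  opposite-involutive (bottom a) , opposite-involutive (top a) ,
  λ j _ _ → trans (flipSide-involutive _) (cong (side a) (opposite-involutive j))
  where
  flipSide-involutive : ∀ s → flipSide (flipSide s) ≡ s
  flipSide-involutive left  = refl
  flipSide-involutive right = refl

∈δ-resp-≈ᵃ : {a b : Arc n} {π : Permutation′ n} → a ≈ᵃ b → a ∈δ π → b ∈δ π
∈δ-resp-≈ᵃ {π = π} (bot≡ , top≡ , side≡) (i , i' , adj , desc , topa , bota , sides) =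
  i , i' , adj , desc , trans (sym top≡) topa , trans (sym bot≡) bota ,
  λ j lo hi → let sameSide = side≡ (π ⟨$⟩ʳ j) (subst (_< _) (sym bota) lo)
                                              (subst (_ <_) (sym topa) hi)
              in  trans (sym sameSide) ∘ proj₁ (sides j lo hi) ,
                  trans (sym sameSide) ∘ proj₂ (sides j lo hi)

halfTurn-∈δ : {σ π : Permutation′ n} {a : Arc n} → σ Mirrors π → a ∈δ π → halfTurn a ∈δ σ
halfTurn-∈δ {σ = σ} {π} {a} σ∼π (i , i' , adj , desc , topa , bota , sides) =
  opposite i' , opposite i , opposite-adjacent adj ,
  subst₂ _<_ (sym (mirror σ∼π i)) (sym (mirror σ∼π i')) (opposite-reverses-< desc) ,
  trans (cong opposite bota) (sym (mirror σ∼π i')) ,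
  trans (cong opposite topa) (sym (mirror σ∼π i)) ,
  mirroredSides
  where
  σ-at : ∀ j → σ ⟨$⟩ʳ j ≡ opposite (π ⟨$⟩ʳ opposite j)
  σ-at j = trans (cong (σ ⟨$⟩ʳ_) (sym (opposite-involutive j))) (mirror σ∼π (opposite j))

  flipped : ∀ j s → side a (π ⟨$⟩ʳ opposite j) ≡ s → side (halfTurn a) (σ ⟨$⟩ʳ j) ≡ flipSide s
  flipped j _ eq = cong flipSide (trans (cong (side a) (sym (mirror (mirrors-sym σ∼π) j))) eq)

  mirroredSides : ∀ j → σ ⟨$⟩ʳ opposite i < σ ⟨$⟩ʳ j → σ ⟨$⟩ʳ j < σ ⟨$⟩ʳ opposite i' →
    (j < opposite i' → side (halfTurn a) (σ ⟨$⟩ʳ j) ≡ right) ×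
    (opposite i < j → side (halfTurn a) (σ ⟨$⟩ʳ j) ≡ left)
  mirroredSides j lo hi =
    (λ j<i' → flipped j left (proj₂ (sides (opposite j) lo' hi') (<-opposite-swap j<i'))) ,
    (λ i<j  → flipped j right (proj₁ (sides (opposite j) lo' hi') (opposite-<-swap i<j)))
    where
    lo' : π ⟨$⟩ʳ i' < π ⟨$⟩ʳ opposite j
    lo' = opposite-reflects-< {i = π ⟨$⟩ʳ i'} (subst₂ _<_ (σ-at j) (mirror σ∼π i') hi)
    hi' : π ⟨$⟩ʳ opposite j < π ⟨$⟩ʳ i
    hi' = opposite-reflects-< {j = π ⟨$⟩ʳ i} (subst₂ _<_ (mirror σ∼π i) (σ-at j) lo)

proposition3p9 : (n : ℕ) (π : Permutation′ n) (a : Arc n) →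
    ((a ∈δ conjW0 π) → Σ (Arc n) λ b → (b ∈δ π) × (halfTurn b ≈ᵃ a)) ×
    ((Σ (Arc n) λ b → (b ∈δ π) × (halfTurn b ≈ᵃ a)) → a ∈δ conjW0 π)
proposition3p9 n π a =
  (λ a∈δw₀πw₀ → halfTurn a ,
                halfTurn-∈δ {a = a} (mirrors-sym (conjW0-mirrors π)) a∈δw₀πw₀ ,
                halfTurn-involutive a) ,
  (λ { (b , b∈δπ , b↻≈a) →
          ∈δ-resp-≈ᵃ {π = conjW0 π} b↻≈a (halfTurn-∈δ {a = b} (conjW0-mirrors π) b∈δπ) })
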